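{- Let $G$ be a connected graph and let $H$ be its peripheral subgraph. If $H$ is connected, then $\mathrm{rad}(H)\ge \mathrm{diam}(G)$ and $|H|\ge 2\,\mathrm{diam}(G)$.
   Context: All graphs are finite and simple. For a connected graph $G$, the eccentricity of a vertex $v$ is $e(v)=\max\{d(v,u): u\in V(G)\}$; $\mathrm{rad}(G)$ and $\mathrm{diam}(G)$ are the minimum and maximum eccentricities. The periphery $P(G)$ is the set of vertices $v$ with $e(v)=\mathrm{diam}(G)$, and the peripheral subgraph is the subgraph of $G$ induced by $P(G)$. $|H|$ denotes the number of vertices of $H$; the radius of $H$ is computed with distances in $H$. -}

module Defs where

open import Data.Nat using (ℕ; zero; suc; _≤_)
open import Data.Bool using (Bool; true; false)
open import Data.Fin using (Fin)
open import Data.Fin.Subset using (Subset; _∈_; ⊤)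
open import Data.Product using (Σ; ∃; _×_)
open import Relation.Binary.PropositionalEquality using (_≡_)

record Graph (n : ℕ) : Set where
  field
    adj     : Fin n → Fin n → Bool
    adj-sym : ∀ u v → adj u v ≡ adj v u
    irrefl  : ∀ u → adj u u ≡ false

open Graph public

module _ {n : ℕ} (G : Graph n) (S : Subset n) where

  -- Walks of length k from u to w all of whose vertices lie in S
  -- (i.e. walks in the subgraph of G induced by S).
  data Walk : Fin n → Fin n → ℕ → Set where
    here : ∀ {u} → u ∈ S → Walk u u 0
    step : ∀ {u v w k} → u ∈ S → adj G u v ≡ true → Walk v w k → Walk u w (suc k)

  Connected : Set
  Connected = ∀ u v → u ∈ S → v ∈ S → ∃ λ k → Walk u v k

  Dist : Fin n → Fin n → ℕ → Set
  Dist u v k = Walk u v k × (∀ m → Walk u v m → k ≤ m)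

  Ecc : Fin n → ℕ → Set
  Ecc v e = v ∈ S
          × (∀ u → u ∈ S → ∀ k → Dist v u k → k ≤ e)
          × (Σ (Fin n) λ u → u ∈ S × Dist v u e)

  Diam : ℕ → Set
  Diam D = (Σ (Fin n) λ v → Ecc v D) × (∀ v e → Ecc v e → e ≤ D)

  Rad : ℕ → Set
  Rad r = (Σ (Fin n) λ v → Ecc v r) × (∀ v e → Ecc v e → r ≤ e)

{-# OPTIONS --safe #-}
-- A vertex at distance D = diam(G) from a peripheral vertex is again peripheral, and
-- walks in H are walks in G, so every vertex of H has eccentricity at least D in H;
-- this gives rad(H) ≥ D. For the order, look at the spheres of H around a vertex c.
-- If each sphere of radius 1, …, D - 1 has two vertices, these, c and a vertex at
-- distance ≥ D from c are 2D vertices. Otherwise some sphere of radius i < D is a single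
-- vertex, and moving c one step towards it lowers a bound on its eccentricity; as
-- eccentricities in H stay ≥ D, this can happen only finitely often.

module Submission where

open import Defs
open import Data.Nat using (ℕ; zero; suc; _≤_; _<_; _*_; _+_; _∸_; z≤n; s≤s; _≤?_; _⊔_)
open import Data.Nat.Properties
open import Data.Nat.Induction using (<-rec)
open import Data.Bool using (true; false)
import Data.Bool as Bool
open import Data.Fin using (Fin; zero; suc) renaming (_≟_ to _≟ᶠ_)
open import Data.Fin.Subset using (Subset; _∈_; _⊆_; ⊤; ∣_∣; _-_)
open import Data.Fin.Subset.Properties using (_∈?_; ∈⊤; x∈p∧x≢y⇒x∈p-y; x∈p⇒∣p-x∣<∣p∣)
open import Data.Fin.Properties using (any?)
open import Data.Vec.Base using (here; there) renaming (_∷_ to _∷ᵛ_)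
open import Data.List using (List; []; _∷_; length; allFin)
open import Data.List.Relation.Unary.All as All using (All; []; _∷_)
open import Data.List.Relation.Unary.AllPairs using ([]; _∷_)
open import Data.List.Relation.Unary.Unique.Propositional using (Unique)
open import Data.List.Membership.Propositional.Properties using (∈-allFin)
open import Data.List.Extrema.Nat using (argmax; f[xs]≤f[argmax])
open import Data.Product using (∃; ∃₂; _×_; _,_; proj₁; proj₂)
open import Data.Empty using (⊥-elim)
open import Relation.Unary using (Pred; Decidable)
open import Relation.Nullary using (¬_; Dec; yes; no)
open import Relation.Nullary.Decidable using (_×-dec_; ¬?; decidable-stable)
open import Relation.Binary.PropositionalEquality using (_≡_; _≢_; refl; sym; trans; cong; subst)
open import Function.Base using (_∘′_)
open import Function.Bundles using (_⇔_; Equivalence)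

least-witness : ∀ {q} {Q : Pred ℕ q} → Decidable Q →
                ∀ {k} → Q k → ∃ λ m → Q m × (∀ j → Q j → m ≤ j)
least-witness {Q = Q} Q? {k} = <-rec (λ k → Q k → ∃ λ m → Q m × (∀ j → Q j → m ≤ j)) search k
  where
  search : ∀ k → (∀ {j} → j < k → Q j → ∃ λ m → Q m × (∀ j → Q j → m ≤ j)) →
           Q k → ∃ λ m → Q m × (∀ j → Q j → m ≤ j)
  search k below qk with anyUpTo? Q? k
  ... | yes (j , j<k , qj) = below j<k qj
  ... | no none = k , qk , λ j qj → ≮⇒≥ λ j<k → none (j , j<k , qj)

uniform-bound : ∀ {n r} (p : Subset n) (R : Fin n → ℕ → Set r) → (∀ x → x ∈ p → ∃ (R x)) →
                ∃ λ e → ∀ x → x ∈ p → ∃ λ k → k ≤ e × R x k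
uniform-bound {zero} p R h = 0 , λ ()
uniform-bound {suc n} (b ∷ᵛ p) R h with uniform-bound p (λ x → R (suc x)) (λ x x∈p → h (suc x) (there x∈p))
uniform-bound {suc n} (false ∷ᵛ p) R h | e , bound = e , λ { (suc x) (there x∈p) → bound x x∈p }
uniform-bound {suc n} (true ∷ᵛ p) R h | e , bound with h zero here
... | k₀ , r₀ = k₀ ⊔ e , λ
  { zero here → k₀ , m≤m⊔n k₀ e , r₀
  ; (suc x) (there x∈p) → let (k , k≤e , r) = bound x x∈p in k , ≤-trans k≤e (m≤n⊔m k₀ e) , r
  }

unique-length≤∣p∣ : ∀ {n} (p : Subset n) {xs : List (Fin n)} → Unique xs → All (_∈ p) xs → length xs ≤ ∣ p ∣
unique-length≤∣p∣ p [] [] = z≤n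
unique-length≤∣p∣ p {x ∷ xs} (x∉xs ∷ unique) (x∈p ∷ xs⊆p) =
  ≤-trans (s≤s (unique-length≤∣p∣ (p - x) unique (All.zipWith remove (x∉xs , xs⊆p)))) (x∈p⇒∣p-x∣<∣p∣ x∈p)
  where
  remove : ∀ {y} → x ≢ y × y ∈ p → y ∈ p - x
  remove (x≢y , y∈p) = x∈p∧x≢y⇒x∈p-y y∈p (λ y≡x → x≢y (sym y≡x))

module Walks {n : ℕ} (G : Graph n) (S : Subset n) where

  walk-source : ∀ {u v k} → Walk G S u v k → u ∈ S
  walk-source (here u∈S) = u∈S
  walk-source (step u∈S _ _) = u∈S

  walk-target : ∀ {u v k} → Walk G S u v k → v ∈ S
  walk-target (here v∈S) = v∈S
  walk-target (step _ _ w) = walk-target w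

  _++ʷ_ : ∀ {u v w k m} → Walk G S u v k → Walk G S v w m → Walk G S u w (k + m)
  here _ ++ʷ w₂ = w₂
  step u∈S uv w₁ ++ʷ w₂ = step u∈S uv (w₁ ++ʷ w₂)

  snoc : ∀ {u v w k} → Walk G S u v k → adj G v w ≡ true → w ∈ S → Walk G S u w (suc k)
  snoc (here v∈S) vw w∈S = step v∈S vw (here w∈S)
  snoc (step u∈S uu' w) vw w∈S = step u∈S uu' (snoc w vw w∈S)

  reverse : ∀ {u v k} → Walk G S u v k → Walk G S v u k
  reverse (here u∈S) = here u∈S
  reverse (step u∈S uv w) = snoc (reverse w) (trans (adj-sym G _ _) uv) u∈S

  splitAt : ∀ {u w j k} → j ≤ k → Walk G S u w k → ∃ λ y → Walk G S u y j × Walk G S y w (k ∸ j)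
  splitAt z≤n w = _ , here (walk-source w) , w
  splitAt (s≤s j≤k) (step u∈S uv w) with splitAt j≤k w
  ... | y , w₁ , w₂ = y , step u∈S uv w₁ , w₂

  walk? : ∀ u v k → Dec (Walk G S u v k)
  walk? u v zero with u ≟ᶠ v | u ∈? S
  ... | yes refl | yes u∈S = yes (here u∈S)
  ... | yes refl | no u∉S = no λ { (here u∈S) → u∉S u∈S }
  ... | no u≢v | _ = no λ { (here _) → u≢v refl }
  walk? u v (suc k) with u ∈? S | any? (λ w → (adj G u w Bool.≟ true) ×-dec walk? w v k)
  ... | yes u∈S | yes (w , uw , wv) = yes (step u∈S uw wv)
  ... | no u∉S | _ = no λ { (step u∈S _ _) → u∉S u∈S }
  ... | yes _ | no none = no λ { (step _ uw wv) → none (_ , uw , wv) }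

  walk⇒dist : ∀ {u v k} → Walk G S u v k → ∃ (Dist G S u v)
  walk⇒dist {u} {v} w = least-witness (walk? u v) w

  dist-unique : ∀ {u v k m} → Dist G S u v k → Dist G S u v m → k ≡ m
  dist-unique (w₁ , min₁) (w₂ , min₂) = ≤-antisym (min₁ _ w₂) (min₂ _ w₁)

  dist-refl : ∀ {u} → u ∈ S → Dist G S u u 0
  dist-refl u∈S = here u∈S , λ _ _ → z≤n

  dist-sym : ∀ {u v k} → Dist G S u v k → Dist G S v u k
  dist-sym (w , min) = reverse w , λ m w' → min m (reverse w')

  dist? : ∀ u v k → Dec (Dist G S u v k)
  dist? u v k with walk? u v k | anyUpTo? (walk? u v) k
  ... | no ¬w | _ = no λ d → ¬w (proj₁ d)
  ... | yes _ | yes (m , m<k , w') = no λ d → <⇒≱ m<k (proj₂ d m w')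
  ... | yes w | no none = yes (w , λ m w' → ≮⇒≥ λ m<k → none (m , m<k , w'))

  dist-prefix : ∀ {u w j k} → j ≤ k → Dist G S u w k →
                ∃ λ y → Dist G S u y j × Walk G S y w (k ∸ j)
  dist-prefix {j = j} {k} j≤k (wk , min) with splitAt j≤k wk
  ... | y , w₁ , w₂ = y , (w₁ , shortest) , w₂
    where
    shortest : ∀ m → Walk G S _ y m → j ≤ m
    shortest m w' = ≮⇒≥ λ m<j → <⇒≱ (shorter m<j) (min _ (w' ++ʷ w₂))
      where
      shorter : m < j → m + (k ∸ j) < k
      shorter m<j = subst (m + (k ∸ j) <_) (m+[n∸m]≡n j≤k) (+-monoˡ-< (k ∸ j) m<j)

walk-mono : ∀ {n} (G : Graph n) {S T : Subset n} {u v k} → S ⊆ T → Walk G S u v k → Walk G T u v k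
walk-mono G S⊆T (here u∈S) = here (S⊆T u∈S)
walk-mono G S⊆T (step u∈S uv w) = step (S⊆T u∈S) uv (walk-mono G S⊆T w)

module Eccentricity {n : ℕ} (G : Graph n) (S : Subset n) where

  open Walks G S

  EccAtLeast : Fin n → ℕ → Set
  EccAtLeast c D = ∃ λ u → u ∈ S × (∀ k → Walk G S c u k → D ≤ k)

  EccAtMost : Fin n → ℕ → Set
  EccAtMost c e = ∀ x → x ∈ S → ∃ λ k → k ≤ e × Walk G S c x k

  EccAtLeast-≤-EccAtMost : ∀ {c D e} → EccAtLeast c D → EccAtMost c e → D ≤ e
  EccAtLeast-≤-EccAtMost (u , u∈S , far) near with near u u∈S
  ... | k , k≤e , w = ≤-trans (far k w) k≤e

  Ecc⇒EccAtMost : Connected G S → ∀ {c e} → Ecc G S c e → EccAtMost c e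
  Ecc⇒EccAtMost conn (c∈S , bound , _) x x∈S with walk⇒dist (proj₂ (conn _ x c∈S x∈S))
  ... | d , dist = d , bound x x∈S d dist , proj₁ dist

  EccAtMost-exists : Connected G S → ∀ {c} → c ∈ S → ∃ (EccAtMost c)
  EccAtMost-exists conn {c} c∈S = uniform-bound S (Walk G S c) (λ x x∈S → conn c x c∈S x∈S)

  InBall : Fin n → ℕ → Fin n → Set
  InBall c j x = ∃ λ m → m ≤ j × Dist G S c x m

  SphereHasTwo : Fin n → ℕ → Set
  SphereHasTwo c i = ∃₂ λ x y → x ≢ y × Dist G S c x i × Dist G S c y i

  sphereHasTwo? : ∀ c i → Dec (SphereHasTwo c i)
  sphereHasTwo? c i = any? λ x → any? λ y → ¬? (x ≟ᶠ y) ×-dec dist? c x i ×-dec dist? c y i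

  sphere-singleton : ∀ {c i x} → ¬ SphereHasTwo c i → Dist G S c x i → ∀ y → Dist G S c y i → y ≡ x
  sphere-singleton {x = x} ¬two dx y dy with y ≟ᶠ x
  ... | yes y≡x = y≡x
  ... | no y≢x = ⊥-elim (¬two (y , x , y≢x , dy , dx))

  sphere-inhabited : ∀ {c D e i} → EccAtLeast c D → EccAtMost c e → i ≤ D → ∃ λ x → Dist G S c x i
  sphere-inhabited (u , u∈S , far) near i≤D with near u u∈S
  ... | _ , _ , w with walk⇒dist w
  ...   | d , du with dist-prefix (≤-trans i≤D (far d (proj₁ du))) du
  ...     | x , dx , _ = x , dx

  outside-ball : ∀ {c j x y d} → j < d → Dist G S c x d → InBall c j y → x ≢ y
  outside-ball j<d dx (m , m≤j , dy) refl = <⇒≱ (≤-<-trans m≤j j<d) (≤-reflexive (dist-unique dx dy))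

  far-outside-ball : ∀ {c j y} → (u : EccAtLeast c (suc j)) → InBall c j y → proj₁ u ≢ y
  far-outside-ball (_ , _ , far) (m , m≤j , dy) refl = <⇒≱ (s≤s m≤j) (far m (proj₁ dy))

  ball-list : ∀ {c} → c ∈ S → ∀ j → (∀ i → i < j → SphereHasTwo c (suc i)) →
              ∃ λ L → length L ≡ suc (2 * j) × Unique L × All (InBall c j) L
  ball-list {c} c∈S zero _ = c ∷ [] , refl , [] ∷ [] , (0 , z≤n , dist-refl c∈S) ∷ []
  ball-list {c} c∈S (suc j) two with ball-list c∈S j (λ i i<j → two i (m≤n⇒m≤1+n i<j)) | two j ≤-refl
  ... | L , len , unique , inBall | x , y , x≢y , dx , dy =
    x ∷ y ∷ L ,
    trans (cong (suc ∘′ suc) len) (cong suc (sym (*-suc 2 j))) ,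
    (x≢y ∷ All.map (outside-ball ≤-refl dx) inBall) ∷ All.map (outside-ball ≤-refl dy) inBall ∷ unique ,
    (suc j , ≤-refl , dx) ∷ (suc j , ≤-refl , dy) ∷ All.map grow inBall
    where
    grow : ∀ {z} → InBall c j z → InBall c (suc j) z
    grow (m , m≤j , dz) = m , m≤n⇒m≤1+n m≤j , dz

  full-spheres⇒order : ∀ {c j} → c ∈ S → EccAtLeast c (suc j) →
                       (∀ i → i < j → SphereHasTwo c (suc i)) → 2 * suc j ≤ ∣ S ∣
  full-spheres⇒order {j = j} c∈S far two with ball-list c∈S j two
  ... | L , len , unique , inBall =
    subst (_≤ ∣ S ∣) (trans (cong suc len) (sym (*-suc 2 j)))
      (unique-length≤∣p∣ S (All.map (far-outside-ball far) inBall ∷ unique)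
                           (proj₁ (proj₂ far) ∷ All.map (λ (_ , _ , dz) → walk-target (proj₁ dz)) inBall))

  -- If the sphere of radius i around c is a single vertex c′, every walk from c leaving
  -- the ball of radius i - 1 passes through c′; so stepping towards c′ shortens all of
  -- them, while vertices inside that ball stay within reach.
  recentre : ∀ {c c′ e m} → EccAtMost c (suc e) → suc m ≤ e → Dist G S c c′ (suc m) →
             (∀ x → Dist G S c x (suc m) → x ≡ c′) → ∃ λ c₁ → c₁ ∈ S × EccAtMost c₁ e
  recentre {c} {c′} {e} {m} near sm≤e (step c∈S cc₁ c₁c′ , _) singleton =
    _ , walk-source c₁c′ , reach
    where
    c₁c : adj G _ c ≡ true
    c₁c = trans (adj-sym G _ _) cc₁

    reach : EccAtMost _ e
    reach x x∈S with near x x∈S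
    ... | k , k≤se , w with walk⇒dist w
    ...   | d , dx with suc m ≤? d
    ...     | yes sm≤d with dist-prefix sm≤d dx
    ...       | y , dy , yx =
      m + (d ∸ suc m) ,
      ≤-pred (subst (_≤ suc e) (sym (m+[n∸m]≡n sm≤d)) (≤-trans (proj₂ dx k w) k≤se)) ,
      (c₁c′ ++ʷ subst (λ z → Walk G S z x (d ∸ suc m)) (singleton y dy) yx)
    reach x x∈S | _ | d , dx | no sm≰d =
      suc d , ≤-trans (≰⇒> sm≰d) sm≤e , step (walk-source c₁c′) c₁c (proj₁ dx)

  descent : ∀ {j} → (∀ c → c ∈ S → EccAtLeast c (suc j)) →
            ∀ e {c} → c ∈ S → EccAtMost c e → 2 * suc j ≤ ∣ S ∣
  descent far zero c∈S near with EccAtLeast-≤-EccAtMost (far _ c∈S) near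
  ... | ()
  descent {j} far (suc e) {c} c∈S near with anyUpTo? (λ i → ¬? (sphereHasTwo? c (suc i))) j
  ... | no none =
    full-spheres⇒order c∈S (far c c∈S)
      (λ i i<j → decidable-stable (sphereHasTwo? c (suc i)) λ ¬two → none (i , i<j , ¬two))
  ... | yes (i , i<j , ¬two) with sphere-inhabited (far c c∈S) near (m≤n⇒m≤1+n i<j)
  ...   | c′ , dc′ with recentre near (≤-trans i<j (≤-pred (EccAtLeast-≤-EccAtMost (far c c∈S) near)))
                                dc′ (sphere-singleton ¬two dc′)
  ...     | c₁ , c₁∈S , near₁ = descent far e c₁∈S near₁

  order-bound : Connected G S → ∀ {c D} → c ∈ S → (∀ c → c ∈ S → EccAtLeast c D) → 2 * D ≤ ∣ S ∣
  order-bound conn {D = zero} _ _ = z≤n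
  order-bound conn {D = suc j} c∈S far with EccAtMost-exists conn c∈S
  ... | e , near = descent far e c∈S near

module WholeGraph {n : ℕ} (G : Graph n) (conn : Connected G ⊤) where

  open Walks G ⊤

  ecc-exists : ∀ u → ∃ (Ecc G ⊤ u)
  ecc-exists u = d x* , ∈⊤ , bound , x* , ∈⊤ , proj₂ (dist x*)
    where
    dist : ∀ x → ∃ (Dist G ⊤ u x)
    dist x = walk⇒dist (proj₂ (conn u x ∈⊤ ∈⊤))

    d : Fin n → ℕ
    d x = proj₁ (dist x)

    x* : Fin n
    x* = argmax d u (allFin n)

    bound : ∀ y → y ∈ ⊤ → ∀ k → Dist G ⊤ u y k → k ≤ d x*
    bound y _ k dy = subst (_≤ d x*) (dist-unique (proj₂ (dist y)) dy)
                           (All.lookup (f[xs]≤f[argmax] {f = d} u (allFin n)) (∈-allFin y))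

  dist≤diam : ∀ {D} → Diam G ⊤ D → ∀ {u y k} → Dist G ⊤ u y k → k ≤ D
  dist≤diam {D} (_ , maximal) {u} {y} {k} duy = bounded (ecc-exists u)
    where
    bounded : ∃ (Ecc G ⊤ u) → k ≤ D
    bounded (e , ecc@(_ , bound , _)) = ≤-trans (bound y ∈⊤ k duy) (maximal u e ecc)

  antipode-peripheral : ∀ {D c u} → Diam G ⊤ D → Dist G ⊤ c u D → Ecc G ⊤ u D
  antipode-peripheral diam dcu = ∈⊤ , (λ _ _ _ → dist≤diam diam) , _ , ∈⊤ , dist-sym dcu

lemma3 : ∀ {n} (G : Graph n) (D : ℕ) (P : Subset n)
         → Connected G ⊤
         → Diam G ⊤ D
         → (∀ v → (v ∈ P) ⇔ Ecc G ⊤ v D)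
         → Connected G P
         → (∀ r → Rad G P r → D ≤ r) × (2 * D ≤ ∣ P ∣)
lemma3 G D P connG diam@((v , ecc-v) , _) peripheral connH =
  (λ r ((c , ecc-c) , _) → EccAtLeast-≤-EccAtMost (far c (proj₁ ecc-c)) (Ecc⇒EccAtMost connH ecc-c)) ,
  order-bound connH (from (peripheral v) ecc-v) far
  where
  open Equivalence
  open Eccentricity G P
  open WholeGraph G connG

  far : ∀ c → c ∈ P → EccAtLeast c D
  far c c∈P with to (peripheral c) c∈P
  ... | _ , _ , u , _ , dcu =
    u , from (peripheral u) (antipode-peripheral diam dcu) , λ k w → proj₂ dcu k (walk-mono G (λ _ → ∈⊤) w)
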